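{- Let $n$, $r$, $a$ be positive integers with $n=2r+1$ and $a\ge 2$. Then $\rho_2(n+2a,r+a)\ge 2\rho_2(n,r)$.
   Context: For integers $n\ge 2r\ge 2$, the Kneser graph $K(n,r)$ has as vertices the $r$-element subsets of $[n]=\{1,\dots,n\}$, two vertices being adjacent iff they are disjoint. A 2-packing of a graph is a set of vertices that are pairwise at distance at least $3$ (no two adjacent and no two with a common neighbor); $\rho_2(G)$ is the maximum cardinality of a 2-packing, and $\rho_2(n,r)=\rho_2(K(n,r))$. -}

module Defs where

open import Data.Nat using (ℕ)
open import Data.Fin.Subset using (Subset; ∣_∣; _∩_; Empty)
open import Data.List using (List; length)
open import Data.List.Membership.Propositional using (_∈_)
open import Data.List.Relation.Unary.Unique.Propositional using (Unique)
open import Data.Product using (Σ; _×_)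
open import Relation.Binary.PropositionalEquality using (_≡_; _≢_)
open import Relation.Nullary using (¬_)

-- Vertices of the Kneser graph K(n,r): r-element subsets of [n] (as Subset n).
IsVertex : (n r : ℕ) → Subset n → Set
IsVertex n r s = ∣ s ∣ ≡ r

Adj : {n : ℕ} → Subset n → Subset n → Set
Adj s t = Empty (s ∩ t)

-- A 2-packing of K(n,r): a duplicate-free list of vertices, pairwise at
-- distance ≥ 3, i.e. any two distinct members are not adjacent and have
-- no common neighbour (vertex of K(n,r)).
Is2Packing : (n r : ℕ) → List (Subset n) → Set
Is2Packing n r P =
  Unique P ×
  ((s : Subset n) → s ∈ P → IsVertex n r s) ×
  ((u v : Subset n) → u ∈ P → v ∈ P → u ≢ v →
     ¬ Adj u v ×
     ((w : Subset n) → IsVertex n r w → ¬ (Adj u w × Adj v w)))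

-- "ρ₂(n,r) = k": k is the maximum cardinality of a 2-packing of K(n,r).
IsRho2 : (n r k : ℕ) → Set
IsRho2 n r k =
  Σ (List (Subset n)) (λ P → Is2Packing n r P × length P ≡ k) ×
  ((P : List (Subset n)) → Is2Packing n r P → length P Data.Nat.≤ k)

-- Append to every vertex u of a 2-packing P of K(n,r) either the tag t = 1^a 0^a or its
-- complement.  A common neighbour of u ++ t and v ++ t' (u ≠ v) misses the a ones of t, so at
-- least r of its points lie in [n]; any r of them form a common neighbour of u and v.  A common
-- neighbour of u ++ t and u ++ ∁ t misses the whole tail, so it is an (r+a)-set in [n] disjoint
-- from the r-set u, impossible when n < 2r + a.  Hence the 2|P| tagged sets form a 2-packing
-- of K(n+2a, r+a).
module Submission where

open import Defs
open import Data.Empty using (⊥-elim)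
open import Data.Fin using (Fin; _↑ˡ_; _↑ʳ_)
open import Data.Fin.Subset
  using (Subset; inside; outside; ∣_∣; _∩_; _∪_; ∁; ⊤; ⊥; _∈_; _⊆_; Empty)
open import Data.Fin.Subset.Properties
  using ( _∈?_; x∈p∩q⁺; x∈p∩q⁻; x∈p∪q⁻; x∉p⇒x∈∁p; x∈∁p⇒x∉p; ∈⊤; ⊥⊆; s⊆s; ∩-idem; ∪-comm
        ; p∪∁p≡⊤; Empty-unique; ∣⊥∣≡0; ∣⊤∣≡n; ∣p∣≤n; ∣∁p∣≡n∸∣p∣; p⊆q⇒∣p∣≤∣q∣ )
open import Data.List using (List; length; map) renaming (_++_ to _++ᴸ_)
open import Data.List.Properties using (length-++; length-map)
import Data.List.Membership.Propositional as List
open import Data.List.Membership.Propositional.Properties using (∈-++⁻; ∈-map⁻)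
open import Data.List.Relation.Unary.Unique.Propositional using (Unique)
open import Data.List.Relation.Unary.Unique.Propositional.Properties using (++⁺; map⁺)
open import Data.Nat using (ℕ; zero; suc; _+_; _*_; _≤_; _<_; _≥_; s≤s)
open import Data.Nat.Properties
open import Data.Product using (∃; _×_; _,_; proj₁; proj₂)
open import Data.Sum using (_⊎_; inj₁; inj₂)
open import Data.Vec using ([]; _∷_; _++_; splitAt; here; there)
open import Data.Vec.Properties using (++-injectiveˡ; ++-injectiveʳ; ≡-dec)
import Data.Bool.Properties as Bool
open import Relation.Binary.PropositionalEquality
open import Relation.Nullary using (¬_; yes; no)

private
  variable
    n m : ℕ

∈-++⁺ˡ : {i : Fin n} {p : Subset n} {q : Subset m} → i ∈ p → (i ↑ˡ m) ∈ p ++ q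
∈-++⁺ˡ here = here
∈-++⁺ˡ (there i∈p) = there (∈-++⁺ˡ i∈p)

∈-++⁺ʳ : {i : Fin m} (p : Subset n) {q : Subset m} → i ∈ q → (n ↑ʳ i) ∈ p ++ q
∈-++⁺ʳ [] i∈q = i∈q
∈-++⁺ʳ (_ ∷ p) i∈q = there (∈-++⁺ʳ p i∈q)

∣p++q∣≡∣p∣+∣q∣ : (p : Subset n) (q : Subset m) → ∣ p ++ q ∣ ≡ ∣ p ∣ + ∣ q ∣
∣p++q∣≡∣p∣+∣q∣ [] q = refl
∣p++q∣≡∣p∣+∣q∣ (inside ∷ p) q = cong suc (∣p++q∣≡∣p∣+∣q∣ p q)
∣p++q∣≡∣p∣+∣q∣ (outside ∷ p) q = ∣p++q∣≡∣p∣+∣q∣ p q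

∣p∣+∣∁p∣≡n : (p : Subset n) → ∣ p ∣ + ∣ ∁ p ∣ ≡ n
∣p∣+∣∁p∣≡n {n} p = trans (cong (∣ p ∣ +_) (∣∁p∣≡n∸∣p∣ p)) (m+[n∸m]≡n (∣p∣≤n p))

Empty⇒∣p∣≡0 : {p : Subset n} → Empty p → ∣ p ∣ ≡ 0
Empty⇒∣p∣≡0 {n} e = trans (cong ∣_∣ (Empty-unique e)) (∣⊥∣≡0 n)

p≡∁p⇒Empty : {p : Subset n} → p ≡ ∁ p → Empty p
p≡∁p⇒Empty eq (i , i∈p) = x∈∁p⇒x∉p (subst (i ∈_) eq i∈p) i∈p

⊆-ofSize : ∀ r (p : Subset n) → r ≤ ∣ p ∣ → ∃ λ q → q ⊆ p × ∣ q ∣ ≡ r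
⊆-ofSize {n} zero p _ = ⊥ , ⊥⊆ , ∣⊥∣≡0 n
⊆-ofSize (suc r) (inside ∷ p) (s≤s r≤∣p∣) =
  let q , q⊆p , ∣q∣≡r = ⊆-ofSize r p r≤∣p∣ in inside ∷ q , s⊆s q⊆p , cong suc ∣q∣≡r
⊆-ofSize (suc r) (outside ∷ p) r<∣p∣ =
  let q , q⊆p , ∣q∣≡r = ⊆-ofSize (suc r) p r<∣p∣ in outside ∷ q , s⊆s q⊆p , ∣q∣≡r

Adj-⊆ : {p q q′ : Subset n} → Adj p q → q′ ⊆ q → Adj p q′
Adj-⊆ {p = p} {q′ = q′} adj q′⊆q (i , i∈p∩q′) =
  let i∈p , i∈q′ = x∈p∩q⁻ p q′ i∈p∩q′ in adj (i , x∈p∩q⁺ (i∈p , q′⊆q i∈q′))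

Adj-++⁻ : (p : Subset n) (p′ : Subset m) (q : Subset n) (q′ : Subset m) →
          Adj (p ++ p′) (q ++ q′) → Adj p q × Adj p′ q′
Adj-++⁻ p p′ q q′ adj = adjˡ , adjʳ
  where
  adjˡ : Adj p q
  adjˡ (i , i∈p∩q) =
    let i∈p , i∈q = x∈p∩q⁻ p q i∈p∩q in adj (_ , x∈p∩q⁺ (∈-++⁺ˡ i∈p , ∈-++⁺ˡ i∈q))
  adjʳ : Adj p′ q′
  adjʳ (i , i∈p′∩q′) =
    let i∈p′ , i∈q′ = x∈p∩q⁻ p′ q′ i∈p′∩q′
    in adj (_ , x∈p∩q⁺ (∈-++⁺ʳ p i∈p′ , ∈-++⁺ʳ q i∈q′))

Adj-self⇒Empty : {p : Subset n} → Adj p p → Empty p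
Adj-self⇒Empty {p = p} = subst Empty (∩-idem p)

Adj⇒∣p∣+∣q∣≤n : {p q : Subset n} → Adj p q → ∣ p ∣ + ∣ q ∣ ≤ n
Adj⇒∣p∣+∣q∣≤n {n} {p} {q} adj = begin
  ∣ p ∣ + ∣ q ∣   ≤⟨ +-monoʳ-≤ ∣ p ∣ (p⊆q⇒∣p∣≤∣q∣ q⊆∁p) ⟩
  ∣ p ∣ + ∣ ∁ p ∣ ≡⟨ ∣p∣+∣∁p∣≡n p ⟩
  n               ∎
  where
  open ≤-Reasoning
  q⊆∁p : q ⊆ ∁ p
  q⊆∁p {i} i∈q with i ∈? p
  ... | yes i∈p = ⊥-elim (adj (i , x∈p∩q⁺ (i∈p , i∈q)))
  ... | no i∉p = x∉p⇒x∈∁p i∉p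

Adj-∪⇒Empty : {p q w : Subset n} → p ∪ q ≡ ⊤ → Adj p w → Adj q w → Empty w
Adj-∪⇒Empty {p = p} {q} cover adjp adjq (i , i∈w)
  with x∈p∪q⁻ p q (subst (i ∈_) (sym cover) ∈⊤)
... | inj₁ i∈p = adjp (i , x∈p∩q⁺ (i∈p , i∈w))
... | inj₂ i∈q = adjq (i , x∈p∩q⁺ (i∈q , i∈w))

Distant : (n r : ℕ) → Subset n → Subset n → Set
Distant n r u v = ¬ Adj u v × ((w : Subset n) → IsVertex n r w → ¬ (Adj u w × Adj v w))

Distant-++ : ∀ {r a} {u v : Subset n} (x y : Subset m) → m ≤ ∣ x ∣ + a →
             Distant n r u v → Distant (n + m) (r + a) (u ++ x) (v ++ y)
Distant-++ {n} {m} {r} {a} {u} {v} x y m≤∣x∣+a (¬adj , noCommon) =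
  (λ adj → ¬adj (proj₁ (Adj-++⁻ u x v y adj))) , noCommon′
  where
  noCommon′ : (W : Subset (n + m)) → IsVertex (n + m) (r + a) W →
              ¬ (Adj (u ++ x) W × Adj (v ++ y) W)
  noCommon′ W ∣W∣≡r+a (adjuW , adjvW) with splitAt n W
  ... | w , w′ , refl =
    let t , t⊆w , ∣t∣≡r = ⊆-ofSize r w r≤∣w∣
    in noCommon t ∣t∣≡r (Adj-⊆ adjuw t⊆w , Adj-⊆ adjvw t⊆w)
    where
    adjuw : Adj u w
    adjuw = proj₁ (Adj-++⁻ u x w w′ adjuW)
    adjvw : Adj v w
    adjvw = proj₁ (Adj-++⁻ v y w w′ adjvW)
    adjxw′ : Adj x w′
    adjxw′ = proj₂ (Adj-++⁻ u x w w′ adjuW)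
    ∣w′∣≤a : ∣ w′ ∣ ≤ a
    ∣w′∣≤a = +-cancelˡ-≤ ∣ x ∣ ∣ w′ ∣ a
               (≤-trans (Adj⇒∣p∣+∣q∣≤n adjxw′) m≤∣x∣+a)
    r≤∣w∣ : r ≤ ∣ w ∣
    r≤∣w∣ = +-cancelʳ-≤ a r ∣ w ∣ (begin
      r + a             ≡⟨ sym ∣W∣≡r+a ⟩
      ∣ w ++ w′ ∣       ≡⟨ ∣p++q∣≡∣p∣+∣q∣ w w′ ⟩
      ∣ w ∣ + ∣ w′ ∣    ≤⟨ +-monoʳ-≤ ∣ w ∣ ∣w′∣≤a ⟩
      ∣ w ∣ + a         ∎)
      where open ≤-Reasoning

Distant-++-∪ : ∀ {r a} {u : Subset n} {x y : Subset m} → 1 ≤ r → n < 2 * r + a → ∣ u ∣ ≡ r →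
               x ∪ y ≡ ⊤ → Distant (n + m) (r + a) (u ++ x) (u ++ y)
Distant-++-∪ {n} {m} {r} {a} {u} {x} {y} r≥1 n<2r+a ∣u∣≡r cover = ¬adj , noCommon
  where
  ¬adj : ¬ Adj (u ++ x) (u ++ y)
  ¬adj adj = 1+n≰n (subst (1 ≤_) (trans (sym ∣u∣≡r) ∣u∣≡0) r≥1)
    where
    ∣u∣≡0 : ∣ u ∣ ≡ 0
    ∣u∣≡0 = Empty⇒∣p∣≡0 (Adj-self⇒Empty (proj₁ (Adj-++⁻ u x u y adj)))
  noCommon : (W : Subset (n + m)) → IsVertex (n + m) (r + a) W →
             ¬ (Adj (u ++ x) W × Adj (u ++ y) W)
  noCommon W ∣W∣≡r+a (adjuW , adjvW) with splitAt n W
  ... | w , w′ , refl = <⇒≱ n<2r+a (begin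
    2 * r + a        ≡⟨ cong (_+ a) (cong (r +_) (+-identityʳ r)) ⟩
    r + r + a        ≡⟨ +-assoc r r a ⟩
    r + (r + a)      ≡⟨ cong₂ _+_ (sym ∣u∣≡r) (sym ∣w∣≡r+a) ⟩
    ∣ u ∣ + ∣ w ∣    ≤⟨ Adj⇒∣p∣+∣q∣≤n (proj₁ (Adj-++⁻ u x w w′ adjuW)) ⟩
    n                ∎)
    where
    open ≤-Reasoning
    ∣w′∣≡0 : ∣ w′ ∣ ≡ 0
    ∣w′∣≡0 = Empty⇒∣p∣≡0 (Adj-∪⇒Empty cover (proj₂ (Adj-++⁻ u x w w′ adjuW))
                                           (proj₂ (Adj-++⁻ u y w w′ adjvW)))
    ∣w∣≡r+a : ∣ w ∣ ≡ r + a
    ∣w∣≡r+a = begin-equality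
      ∣ w ∣            ≡⟨ sym (+-identityʳ ∣ w ∣) ⟩
      ∣ w ∣ + 0        ≡⟨ cong (∣ w ∣ +_) (sym ∣w′∣≡0) ⟩
      ∣ w ∣ + ∣ w′ ∣   ≡⟨ sym (∣p++q∣≡∣p∣+∣q∣ w w′) ⟩
      ∣ w ++ w′ ∣      ≡⟨ ∣W∣≡r+a ⟩
      r + a            ∎

doubled : List (Subset n) → Subset m → List (Subset (n + m))
doubled P t = map (_++ t) P ++ᴸ map (_++ ∁ t) P

IsTag : Subset m → Subset m → Set
IsTag t y = y ≡ t ⊎ y ≡ ∁ t

∈-doubled⁻ : (P : List (Subset n)) (t : Subset m) {z : Subset (n + m)} → z List.∈ doubled P t →
             ∃ λ u → u List.∈ P × ∃ λ y → IsTag t y × z ≡ u ++ y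
∈-doubled⁻ P t z∈ with ∈-++⁻ (map (_++ t) P) z∈
... | inj₁ z∈ᴸ = let u , u∈P , z≡ = ∈-map⁻ (_++ t) z∈ᴸ in u , u∈P , t , inj₁ refl , z≡
... | inj₂ z∈ᴿ = let u , u∈P , z≡ = ∈-map⁻ (_++ ∁ t) z∈ᴿ in u , u∈P , ∁ t , inj₂ refl , z≡

length-doubled : (P : List (Subset n)) (t : Subset m) → length (doubled P t) ≡ 2 * length P
length-doubled P t = begin
  length (doubled P t)                               ≡⟨ length-++ (map (_++ t) P) ⟩
  length (map (_++ t) P) + length (map (_++ ∁ t) P)  ≡⟨ cong₂ _+_ (length-map _ P) (length-map _ P) ⟩
  length P + length P                                ≡⟨ cong (length P +_) (sym (+-identityʳ _)) ⟩
  2 * length P                                       ∎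
  where open ≡-Reasoning

distinct-tags-cover : (t : Subset m) {y y′ : Subset m} → IsTag t y → IsTag t y′ → y ≢ y′ →
                      y ∪ y′ ≡ ⊤
distinct-tags-cover t (inj₁ refl) (inj₁ refl) y≢y′ = ⊥-elim (y≢y′ refl)
distinct-tags-cover t (inj₁ refl) (inj₂ refl) _ = p∪∁p≡⊤ t
distinct-tags-cover t (inj₂ refl) (inj₁ refl) _ = trans (∪-comm (∁ t) t) (p∪∁p≡⊤ t)
distinct-tags-cover t (inj₂ refl) (inj₂ refl) y≢y′ = ⊥-elim (y≢y′ refl)

doubled-2Packing : ∀ {r a} {P : List (Subset n)} (t : Subset m) → 1 ≤ r → 1 ≤ a → n < 2 * r + a →
                   ∣ t ∣ ≡ a → ∣ ∁ t ∣ ≡ a →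
                   Is2Packing n r P → Is2Packing (n + m) (r + a) (doubled P t)
doubled-2Packing {n} {m} {r} {a} {P} t r≥1 a≥1 n<2r+a ∣t∣≡a ∣∁t∣≡a (unique , vertex , distant) =
  unique′ , vertex′ , distant′
  where
  tag-size : {y : Subset m} → IsTag t y → ∣ y ∣ ≡ a
  tag-size (inj₁ refl) = ∣t∣≡a
  tag-size (inj₂ refl) = ∣∁t∣≡a

  m≤∣tag∣+a : {y : Subset m} → IsTag t y → m ≤ ∣ y ∣ + a
  m≤∣tag∣+a tag = ≤-reflexive (begin
    m                ≡⟨ sym (∣p∣+∣∁p∣≡n t) ⟩
    ∣ t ∣ + ∣ ∁ t ∣  ≡⟨ cong₂ _+_ (trans ∣t∣≡a (sym (tag-size tag))) ∣∁t∣≡a ⟩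
    _ + a            ∎)
    where open ≡-Reasoning

  t≢∁t : t ≢ ∁ t
  t≢∁t t≡∁t = 1+n≰n (subst (1 ≤_) (trans (sym ∣t∣≡a) (Empty⇒∣p∣≡0 (p≡∁p⇒Empty t≡∁t))) a≥1)

  halves-disjoint : ∀ {z} → ¬ (z List.∈ map (_++ t) P × z List.∈ map (_++ ∁ t) P)
  halves-disjoint (z∈ᴸ , z∈ᴿ) with ∈-map⁻ (_++ t) z∈ᴸ | ∈-map⁻ (_++ ∁ t) z∈ᴿ
  ... | u , _ , refl | v , _ , u++t≡v++∁t = t≢∁t (++-injectiveʳ u v u++t≡v++∁t)

  unique′ : Unique (doubled P t)
  unique′ = ++⁺ (map⁺ (++-injectiveˡ _ _) unique) (map⁺ (++-injectiveˡ _ _) unique) halves-disjoint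

  vertex′ : (z : Subset (n + m)) → z List.∈ doubled P t → IsVertex (n + m) (r + a) z
  vertex′ z z∈ with ∈-doubled⁻ P t z∈
  ... | u , u∈P , y , tag , refl =
    trans (∣p++q∣≡∣p∣+∣q∣ u y) (cong₂ _+_ (vertex u u∈P) (tag-size tag))

  distant′ : (z z′ : Subset (n + m)) → z List.∈ doubled P t → z′ List.∈ doubled P t → z ≢ z′ →
             Distant (n + m) (r + a) z z′
  distant′ z z′ z∈ z′∈ z≢z′ with ∈-doubled⁻ P t z∈ | ∈-doubled⁻ P t z′∈
  ... | u , u∈P , y , tag , refl | u′ , u′∈P , y′ , tag′ , refl with ≡-dec Bool._≟_ u u′
  ... | no u≢u′ = Distant-++ y y′ (m≤∣tag∣+a tag) (distant u u′ u∈P u′∈P u≢u′)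
  ... | yes refl = Distant-++-∪ r≥1 n<2r+a (vertex u u∈P)
                     (distinct-tags-cover t tag tag′ (λ y≡y′ → z≢z′ (cong (u ++_) y≡y′)))

halfTag : (a : ℕ) → Subset (2 * a)
halfTag a = ⊤ {a} ++ ⊥

∣halfTag∣ : (a : ℕ) → ∣ halfTag a ∣ ≡ a
∣halfTag∣ a = begin
  ∣ ⊤ {a} ++ ⊥ ∣              ≡⟨ ∣p++q∣≡∣p∣+∣q∣ (⊤ {a}) (⊥ {a + 0}) ⟩
  ∣ ⊤ {a} ∣ + ∣ ⊥ {a + 0} ∣   ≡⟨ cong₂ _+_ (∣⊤∣≡n a) (∣⊥∣≡0 (a + 0)) ⟩
  a + 0                       ≡⟨ +-identityʳ a ⟩
  a                           ∎
  where open ≡-Reasoning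

∣∁halfTag∣ : (a : ℕ) → ∣ ∁ (halfTag a) ∣ ≡ a
∣∁halfTag∣ a = +-cancelˡ-≡ a _ _ (begin
  a + ∣ ∁ (halfTag a) ∣              ≡⟨ cong (_+ ∣ ∁ (halfTag a) ∣) (sym (∣halfTag∣ a)) ⟩
  ∣ halfTag a ∣ + ∣ ∁ (halfTag a) ∣  ≡⟨ ∣p∣+∣∁p∣≡n (halfTag a) ⟩
  a + (a + 0)                        ≡⟨ cong (a +_) (+-identityʳ a) ⟩
  a + a                              ∎)
  where open ≡-Reasoning

mainTheorem9 : (n r a : ℕ) → r ≥ 1 → n ≡ 2 * r + 1 → a ≥ 2 →
    (k m : ℕ) → IsRho2 n r k → IsRho2 (n + 2 * a) (r + a) m →
    2 * k ≤ m
mainTheorem9 n r a r≥1 refl a≥2 k m ((P , P-packing , refl) , _) (_ , maximal) = begin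
  2 * length P                ≡⟨ sym (length-doubled P t) ⟩
  length (doubled P t)        ≤⟨ maximal (doubled P t) doubled-packing ⟩
  m                           ∎
  where
  open ≤-Reasoning
  t : Subset (2 * a)
  t = halfTag a
  doubled-packing : Is2Packing (n + 2 * a) (r + a) (doubled P t)
  doubled-packing = doubled-2Packing t r≥1 (<⇒≤ a≥2) (+-monoʳ-< (2 * r) a≥2)
                      (∣halfTag∣ a) (∣∁halfTag∣ a) P-packing
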